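{- Let $a\geq 1$, $b\geq 1$, $g\geq 3$ be integers. Then $n(a,b,g)\geq M_1^{+}(a,b,g)$ when $g$ is odd; $n(a,b,g)\geq M_2^{+}(a,b,g)$ when $g$ is even; and $n(1,2,10)\geq M_3^{+}(1,2,10)=16$.
   Context: A weighted graph (wgraph) is a pair $G=(L,H)$ of simple finite graphs with $V(L)=V(H)$ and $E(L)\cap E(H)=\varnothing$; edges of $L$ are light (weight 1) and edges of $H$ are heavy (weight 2). A wcycle is a cycle (of length at least 3) in the graph with edge set $E(L)\cup E(H)$; its weight is the sum of the weights of its edges. The girth of $G$ is the minimum weight of a wcycle. $G$ is $(a,b)$-regular if $L$ is $a$-regular and $H$ is $b$-regular. An $(a,b,g)$-wgraph is an $(a,b)$-regular wgraph of girth $g$. $n(a,b,g)$ denotes the minimum order of an $(a,b,g)$-wgraph ($\infty$ if none exists). Given base values $L_0,H_0,L_1,H_1$, define for $i\geq 2$: $L_i=(a-1)L_{i-1}+aH_{i-1}$ and $H_i=(b-1)H_{i-2}+bL_{i-2}$. For odd $g$, $M_1(a,b,g)=\sum_{i=0}^{(g-1)/2}(L_i+H_i)$ with base values $L_0=1,H_0=0,L_1=a,H_1=0$. For even $g$, $M_2(a,b,g)=\sum_{i=0}^{(g-2)/2}(L_i+H_i)$ with base values $L_0=2,H_0=0,L_1=2(a-1),H_1=0$, and $M_3(a,b,g)=\sum_{i=0}^{(g-2)/2}(L_i+H_i)$ with base values $L_0=0,H_0=1,L_1=a,H_1=1$. For $j\in\{1,2,3\}$, $M_j^{+}=M_j+1$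 if $M_j$ is odd and at least one of $a,b$ is odd, and $M_j^{+}=M_j$ otherwise. -}

module Defs where

open import Data.Nat using (ℕ; zero; suc; _+_; _*_; _∸_; _≤_; _%_; _/_; _≡ᵇ_)
open import Data.Bool using (Bool; true; false; if_then_else_; _∧_; _∨_)
open import Data.Fin using (Fin)
open import Data.List using (List; []; _∷_; _++_; take; length; map; allFin)
open import Data.Nat.ListAction using (sum)
open import Data.List.Relation.Unary.All using (All)
open import Data.List.Relation.Unary.Unique.Propositional using (Unique)
open import Data.Product using (Σ; _×_; _,_)
open import Relation.Binary.PropositionalEquality using (_≡_)

record WGraph (n : ℕ) : Set where
  field
    light : Fin n → Fin n → Bool
    heavy : Fin n → Fin n → Bool
    light-sym : ∀ i j → light i j ≡ light j i
    heavy-sym : ∀ i j → heavy i j ≡ heavy j i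
    light-irrefl : ∀ i → light i i ≡ false
    heavy-irrefl : ∀ i → heavy i i ≡ false
    disjoint : ∀ i j → (light i j ∧ heavy i j) ≡ false

open WGraph public

degree : {n : ℕ} → (Fin n → Fin n → Bool) → Fin n → ℕ
degree {n} R i = sum (map (λ j → if R i j then 1 else 0) (allFin n))

IsRegular : {n : ℕ} → WGraph n → ℕ → ℕ → Set
IsRegular G a b = (∀ i → degree (light G) i ≡ a) × (∀ i → degree (heavy G) i ≡ b)

Adj : {n : ℕ} → WGraph n → Fin n → Fin n → Set
Adj G u v = (light G u v ∨ heavy G u v) ≡ true

edgeWeight : {n : ℕ} → WGraph n → Fin n → Fin n → ℕ
edgeWeight G u v = if light G u v then 1 else (if heavy G u v then 2 else 0)

pairs : {A : Set} → List A → List (A × A)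
pairs (x ∷ y ∷ zs) = (x , y) ∷ pairs (y ∷ zs)
pairs _ = []

cycleEdges : {A : Set} → List A → List (A × A)
cycleEdges vs = pairs (vs ++ take 1 vs)

record WCycle {n : ℕ} (G : WGraph n) : Set where
  field
    verts : List (Fin n)
    long : 3 ≤ length verts
    distinct : Unique verts
    adjacent : All (λ e → Adj G (Data.Product.proj₁ e) (Data.Product.proj₂ e)) (cycleEdges verts)

open WCycle public

cycleWeight : {n : ℕ} {G : WGraph n} → WCycle G → ℕ
cycleWeight {G = G} C =
  sum (map (λ e → edgeWeight G (Data.Product.proj₁ e) (Data.Product.proj₂ e)) (cycleEdges (verts C)))

HasGirth : {n : ℕ} → WGraph n → ℕ → Set
HasGirth G g = Σ (WCycle G) (λ C → cycleWeight C ≡ g) × (∀ (C : WCycle G) → g ≤ cycleWeight C)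

IsABG : {n : ℕ} → WGraph n → ℕ → ℕ → ℕ → Set
IsABG G a b g = IsRegular G a b × HasGirth G g

mutual
  Lseq : (a b L0 H0 L1 H1 : ℕ) → ℕ → ℕ
  Lseq a b L0 H0 L1 H1 zero = L0
  Lseq a b L0 H0 L1 H1 (suc zero) = L1
  Lseq a b L0 H0 L1 H1 (suc (suc i)) =
    (a ∸ 1) * Lseq a b L0 H0 L1 H1 (suc i) + a * Hseq a b L0 H0 L1 H1 (suc i)

  Hseq : (a b L0 H0 L1 H1 : ℕ) → ℕ → ℕ
  Hseq a b L0 H0 L1 H1 zero = H0
  Hseq a b L0 H0 L1 H1 (suc zero) = H1
  Hseq a b L0 H0 L1 H1 (suc (suc i)) =
    (b ∸ 1) * Hseq a b L0 H0 L1 H1 i + b * Lseq a b L0 H0 L1 H1 i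

sumUpTo : ℕ → (ℕ → ℕ) → ℕ
sumUpTo zero f = f 0
sumUpTo (suc t) f = sumUpTo t f + f (suc t)

M₁ : ℕ → ℕ → ℕ → ℕ
M₁ a b g = sumUpTo ((g ∸ 1) / 2) (λ i → Lseq a b 1 0 a 0 i + Hseq a b 1 0 a 0 i)

M₂ : ℕ → ℕ → ℕ → ℕ
M₂ a b g = sumUpTo ((g ∸ 2) / 2)
  (λ i → Lseq a b 2 0 (2 * (a ∸ 1)) 0 i + Hseq a b 2 0 (2 * (a ∸ 1)) 0 i)

M₃ : ℕ → ℕ → ℕ → ℕ
M₃ a b g = sumUpTo ((g ∸ 2) / 2) (λ i → Lseq a b 0 1 a 1 i + Hseq a b 0 1 a 1 i)

isOdd : ℕ → Bool
isOdd m = (m % 2) ≡ᵇ 1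

plus : ℕ → ℕ → ℕ → ℕ
plus a b M = if isOdd M ∧ (isOdd a ∨ isOdd b) then suc M else M

M₁⁺ M₂⁺ M₃⁺ : ℕ → ℕ → ℕ → ℕ
M₁⁺ a b g = plus a b (M₁ a b g)
M₂⁺ a b g = plus a b (M₂ a b g)
M₃⁺ a b g = plus a b (M₃ a b g)

{-# OPTIONS --safe #-}
-- Fix a root: a vertex for M₁, a light edge for M₂, a heavy edge for M₃. Sort the
-- non-backtracking walks leaving the root by weight and by the kind of their last edge.
-- A walk whose last edge is light extends by at least a − 1 light and b heavy edges, one
-- whose last edge is heavy by a light and b − 1 heavy edges, so the walks of weight i
-- number at least L_i + H_i. Two distinct such walks of weight at most t ending at the
-- same vertex close a wcycle of weight at most 2t, so below the girth all their endpoints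
-- are distinct vertices and n ≥ M. Finally, if a or b is odd, the handshake lemma makes n
-- even, so an odd M is not attained and n ≥ M + 1.
module Submission where

open import Algebra.Properties.CommutativeMonoid.Sum as ∑ using ()
open import Data.Bool using (Bool; true; false; T; if_then_else_; _∧_; _∨_)
open import Data.Bool.Properties using (T-≡)
open import Data.Empty using (⊥-elim)
open import Data.Fin using (Fin; zero; suc; _≟_)
open import Data.Fin.Properties using (injective⇒≤)
open import Data.List
  using (List; []; _∷_; _++_; map; tabulate; lookup; length; filter; filterᵇ; concatMap; reverseAcc; allFin; drop)
open import Data.List.Membership.Propositional using (_∈_)
open import Data.List.Membership.Propositional.Properties using (∈-lookup)
open import Data.List.Properties using (length-++; length-map; filter-all; concatMap-++; ∷-injectiveˡ)
open import Data.List.Relation.Unary.All as All using (All; []; _∷_)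
import Data.List.Relation.Unary.All.Properties as AllP
open import Data.List.Relation.Unary.All.Properties.Core using (¬Any⇒All¬)
open import Data.List.Relation.Unary.AllPairs using (AllPairs; []; _∷_)
import Data.List.Relation.Unary.AllPairs.Properties as APP
open import Data.List.Relation.Unary.Any using (here; there)
open import Data.List.Relation.Unary.Unique.Propositional using (Unique)
import Data.List.Relation.Unary.Unique.Propositional.Properties as UniqueP
open import Data.Nat using (ℕ; zero; suc; _+_; _*_; _∸_; _≤_; _<_; z≤n; s≤s; _%_; _/_; _≡ᵇ_)
open import Data.Nat.DivMod using (m%n%n≡m%n; %-distribˡ-*; m*n%n≡0; m/n*n≤m)
open import Data.Nat.ListAction using (sum)
open import Data.Nat.Properties hiding (_≟_)
open import Data.Nat.Solver using (module +-*-Solver)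
open import Data.Product using (Σ; _×_; _,_; proj₁; proj₂)
open import Data.Sum using (_⊎_; inj₁; inj₂)
open import Data.Unit using (⊤; tt)
open import Function using (_∘_; Equivalence)
open import Relation.Binary.PropositionalEquality
open import Relation.Nullary using (¬_; yes; no; ¬?; T?)
open import Relation.Nullary.Decidable using (from-yes)

open import Defs

open +-*-Solver using (solve; _:=_; con; _:+_; _:*_)
open ∑ +-0-commutativeMonoid using (sum-syntax; sum-cong-≗; ∑-distrib-+)

-- Sums of the sequences L and H

double-combination : ∀ c d p q → c * (p + p) + d * (q + q) ≡ (c * p + d * q) + (c * p + d * q)
double-combination =
  solve 4 (λ c d p q → c :* (p :+ p) :+ d :* (q :+ q) := (c :* p :+ d :* q) :+ (c :* p :+ d :* q)) refl

Lseq-double : ∀ a b x₀ y₀ x₁ y₁ k →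
  Lseq a b (x₀ + x₀) (y₀ + y₀) (x₁ + x₁) (y₁ + y₁) k ≡ Lseq a b x₀ y₀ x₁ y₁ k + Lseq a b x₀ y₀ x₁ y₁ k
Hseq-double : ∀ a b x₀ y₀ x₁ y₁ k →
  Hseq a b (x₀ + x₀) (y₀ + y₀) (x₁ + x₁) (y₁ + y₁) k ≡ Hseq a b x₀ y₀ x₁ y₁ k + Hseq a b x₀ y₀ x₁ y₁ k

Lseq-double a b x₀ y₀ x₁ y₁ zero = refl
Lseq-double a b x₀ y₀ x₁ y₁ (suc zero) = refl
Lseq-double a b x₀ y₀ x₁ y₁ (suc (suc k)) =
  trans (cong₂ (λ p q → (a ∸ 1) * p + a * q)
               (Lseq-double a b x₀ y₀ x₁ y₁ (suc k)) (Hseq-double a b x₀ y₀ x₁ y₁ (suc k)))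
        (double-combination (a ∸ 1) a (Lseq a b x₀ y₀ x₁ y₁ (suc k)) (Hseq a b x₀ y₀ x₁ y₁ (suc k)))
Hseq-double a b x₀ y₀ x₁ y₁ zero = refl
Hseq-double a b x₀ y₀ x₁ y₁ (suc zero) = refl
Hseq-double a b x₀ y₀ x₁ y₁ (suc (suc k)) =
  trans (cong₂ (λ p q → (b ∸ 1) * p + b * q)
               (Hseq-double a b x₀ y₀ x₁ y₁ k) (Lseq-double a b x₀ y₀ x₁ y₁ k))
        (double-combination (b ∸ 1) b (Hseq a b x₀ y₀ x₁ y₁ k) (Lseq a b x₀ y₀ x₁ y₁ k))

sumUpTo-cong : ∀ t {f g : ℕ → ℕ} → (∀ i → f i ≡ g i) → sumUpTo t f ≡ sumUpTo t g
sumUpTo-cong zero f≗g = f≗g 0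
sumUpTo-cong (suc t) f≗g = cong₂ _+_ (sumUpTo-cong t f≗g) (f≗g (suc t))

sumUpTo-double : ∀ t (f : ℕ → ℕ) → sumUpTo t (λ i → f i + f i) ≡ sumUpTo t f + sumUpTo t f
sumUpTo-double zero f = refl
sumUpTo-double (suc t) f rewrite sumUpTo-double t f =
  solve 2 (λ s x → (s :+ s) :+ (x :+ x) := (s :+ x) :+ (s :+ x)) refl (sumUpTo t f) (f (suc t))

-- M₂ counts the walks of the two trees at the ends of a light edge.
M₂-double : ∀ a b g →
  let S = sumUpTo ((g ∸ 2) / 2) (λ i → Lseq a b 1 0 (a ∸ 1) 0 i + Hseq a b 1 0 (a ∸ 1) 0 i)
  in M₂ a b g ≡ S + S
M₂-double a b g =
  trans (sumUpTo-cong ((g ∸ 2) / 2) doubled) (sumUpTo-double ((g ∸ 2) / 2) (λ i → L i + H i))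
  where
  L H : ℕ → ℕ
  L = Lseq a b 1 0 (a ∸ 1) 0
  H = Hseq a b 1 0 (a ∸ 1) 0
  2*≡+ : 2 * (a ∸ 1) ≡ (a ∸ 1) + (a ∸ 1)
  2*≡+ = cong ((a ∸ 1) +_) (+-identityʳ (a ∸ 1))
  doubled : ∀ i →
    Lseq a b 2 0 (2 * (a ∸ 1)) 0 i + Hseq a b 2 0 (2 * (a ∸ 1)) 0 i ≡ (L i + H i) + (L i + H i)
  doubled i rewrite 2*≡+ | Lseq-double a b 1 0 (a ∸ 1) 0 i | Hseq-double a b 1 0 (a ∸ 1) 0 i =
    solve 2 (λ l h → (l :+ l) :+ (h :+ h) := (l :+ h) :+ (l :+ h)) refl (L i) (H i)

k+k≡k*2 : ∀ k → k + k ≡ k * 2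
k+k≡k*2 = solve 1 (λ k → k :+ k := k :* con 2) refl

half+half≤ : ∀ m → m / 2 + m / 2 ≤ m
half+half≤ m = ≤-trans (≤-reflexive (k+k≡k*2 (m / 2))) (m/n*n≤m m 2)

odd-radius : ∀ {g} → 1 ≤ g → (g ∸ 1) / 2 + (g ∸ 1) / 2 < g
odd-radius {suc g} _ = s≤s (half+half≤ g)

even-radius : ∀ {g} → 2 ≤ g → (g ∸ 2) / 2 + 1 + (g ∸ 2) / 2 < g
even-radius {suc zero} (s≤s ())
even-radius {suc (suc g)} _ =
  s≤s (≤-trans (≤-reflexive (cong (_+ g / 2) (+-comm (g / 2) 1))) (s≤s (half+half≤ g)))

-- Parity of the order

false≢true : false ≢ true
false≢true ()

isOdd⇒%2≡1 : ∀ m → isOdd m ≡ true → m % 2 ≡ 1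
isOdd⇒%2≡1 m odd = ≡ᵇ⇒≡ (m % 2) 1 (subst T (sym odd) tt)

%2≡0⇒¬isOdd : ∀ m → m % 2 ≡ 0 → isOdd m ≡ false
%2≡0⇒¬isOdd m even = cong (_≡ᵇ 1) even

even-by-odd-factor : ∀ n d k → n * d ≡ k + k → d % 2 ≡ 1 → n % 2 ≡ 0
even-by-odd-factor n d k n*d≡k+k d-odd = begin
  n % 2                   ≡⟨ sym (m%n%n≡m%n n 2) ⟩
  n % 2 % 2               ≡⟨ cong (_% 2) (sym (*-identityʳ (n % 2))) ⟩
  (n % 2 * 1) % 2         ≡⟨ cong (λ x → (n % 2 * x) % 2) (sym d-odd) ⟩
  (n % 2 * (d % 2)) % 2   ≡⟨ sym (%-distribˡ-* n d 2) ⟩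
  (n * d) % 2             ≡⟨ cong (_% 2) (trans n*d≡k+k (k+k≡k*2 k)) ⟩
  (k * 2) % 2             ≡⟨ m*n%n≡0 k 2 ⟩
  0                       ∎
  where open ≡-Reasoning

indicator : Bool → ℕ
indicator b = if b then 1 else 0

∑-const : ∀ n c → ∑[ i < n ] c ≡ n * c
∑-const zero c = refl
∑-const (suc n) c = cong (c +_) (∑-const n c)

sum-map-tabulate : ∀ {A : Set} n (f : A → ℕ) (g : Fin n → A) →
  sum (map f (tabulate g)) ≡ ∑[ i < n ] f (g i)
sum-map-tabulate zero f g = refl
sum-map-tabulate (suc n) f g = cong (f (g zero) +_) (sum-map-tabulate n f (g ∘ suc))

handshake : ∀ n (R : Fin n → Fin n → Bool) → (∀ i j → R i j ≡ R j i) → (∀ i → R i i ≡ false) →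
  Σ ℕ λ k → ∑[ i < n ] ∑[ j < n ] indicator (R i j) ≡ k + k
handshake zero R _ _ = 0 , refl
handshake (suc n) R R-sym R-irrefl
  with handshake n (λ i j → R (suc i) (suc j)) (λ i j → R-sym (suc i) (suc j)) (R-irrefl ∘ suc)
... | k , inner≡k+k = X + k , (begin
    (indicator (R zero zero) + X)
      + ∑[ i < n ] (indicator (R (suc i) zero) + ∑[ j < n ] indicator (R (suc i) (suc j)))
      ≡⟨ cong₂ _+_ (cong (λ r → indicator r + X) (R-irrefl zero))
                   (∑-distrib-+ (λ i → indicator (R (suc i) zero)) (λ i → ∑[ j < n ] indicator (R (suc i) (suc j)))) ⟩
    X + (∑[ i < n ] indicator (R (suc i) zero) + ∑[ i < n ] ∑[ j < n ] indicator (R (suc i) (suc j)))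
      ≡⟨ cong₂ (λ Y Z → X + (Y + Z)) (sum-cong-≗ (λ i → cong indicator (R-sym (suc i) zero))) inner≡k+k ⟩
    X + (X + (k + k))
      ≡⟨ solve 2 (λ X k → X :+ (X :+ (k :+ k)) := (X :+ k) :+ (X :+ k)) refl X k ⟩
    (X + k) + (X + k) ∎)
  where
  open ≡-Reasoning
  X = ∑[ j < n ] indicator (R zero (suc j))

odd-regular⇒even-order : ∀ {n} (R : Fin n → Fin n → Bool) →
  (∀ i j → R i j ≡ R j i) → (∀ i → R i i ≡ false) →
  ∀ {d} → (∀ i → degree R i ≡ d) → d % 2 ≡ 1 → n % 2 ≡ 0
odd-regular⇒even-order {n} R R-sym R-irrefl {d} regular d-odd
  with handshake n R R-sym R-irrefl
... | k , total≡k+k = even-by-odd-factor n d k n*d≡k+k d-odd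
  where
  open ≡-Reasoning
  n*d≡k+k : n * d ≡ k + k
  n*d≡k+k = begin
    n * d                                   ≡⟨ sym (∑-const n d) ⟩
    ∑[ i < n ] d
      ≡⟨ sum-cong-≗ (λ i → trans (sym (regular i)) (sum-map-tabulate n _ (λ j → j))) ⟩
    ∑[ i < n ] ∑[ j < n ] indicator (R i j) ≡⟨ total≡k+k ⟩
    k + k                                   ∎

regular⇒even-order : ∀ {n} {G : WGraph n} {a b} → IsRegular G a b →
  isOdd a ∨ isOdd b ≡ true → isOdd n ≡ false
regular⇒even-order {n} {G} {a} {b} (light-regular , heavy-regular) a-or-b-odd with isOdd a in a-odd
... | true = %2≡0⇒¬isOdd n
  (odd-regular⇒even-order (light G) (light-sym G) (light-irrefl G) light-regular (isOdd⇒%2≡1 a a-odd))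
... | false = %2≡0⇒¬isOdd n
  (odd-regular⇒even-order (heavy G) (heavy-sym G) (heavy-irrefl G) heavy-regular (isOdd⇒%2≡1 b a-or-b-odd))

plus-≤ : ∀ a b {M n} → M ≤ n → (isOdd a ∨ isOdd b ≡ true → isOdd n ≡ false) → plus a b M ≤ n
plus-≤ a b {M} {n} M≤n parity with isOdd M in M-odd | isOdd a ∨ isOdd b in a-or-b-odd
... | false | _ = M≤n
... | true | false = M≤n
... | true | true =
  ≤∧≢⇒< M≤n (λ M≡n → false≢true (trans (sym (parity refl)) (trans (cong isOdd (sym M≡n)) M-odd)))

unique⇒lookup-injective : ∀ {A : Set} {xs : List A} → Unique xs →
  ∀ {i j} → lookup xs i ≡ lookup xs j → i ≡ j
unique⇒lookup-injective {xs = x ∷ xs} (x∉xs ∷ _) {zero} {zero} _ = refl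
unique⇒lookup-injective {xs = x ∷ xs} (x∉xs ∷ _) {zero} {suc j} x≡xⱼ =
  ⊥-elim (All.lookup x∉xs (∈-lookup {xs = xs} j) x≡xⱼ)
unique⇒lookup-injective {xs = x ∷ xs} (x∉xs ∷ _) {suc i} {zero} xᵢ≡x =
  ⊥-elim (All.lookup x∉xs (∈-lookup {xs = xs} i) (sym xᵢ≡x))
unique⇒lookup-injective {xs = x ∷ xs} (_ ∷ xs-unique) {suc i} {suc j} xᵢ≡xⱼ =
  cong suc (unique⇒lookup-injective xs-unique xᵢ≡xⱼ)

unique-length≤ : ∀ {n} {xs : List (Fin n)} → Unique xs → length xs ≤ n
unique-length≤ {xs = xs} xs-unique = injective⇒≤ {f = lookup xs} (unique⇒lookup-injective xs-unique)

length-filterᵇ : ∀ {A : Set} (p : A → Bool) xs → length (filterᵇ p xs) ≡ sum (map (indicator ∘ p) xs)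
length-filterᵇ p [] = refl
length-filterᵇ p (x ∷ xs) with p x
... | true = cong suc (length-filterᵇ p xs)
... | false = length-filterᵇ p xs

length-remove : ∀ {n} (p : Fin n) {xs} → Unique xs →
  length xs ≤ suc (length (filter (λ y → ¬? (y ≟ p)) xs))
length-remove p {[]} _ = z≤n
length-remove p {x ∷ xs} (x∉xs ∷ xs-unique) with x ≟ p
... | yes refl =
  s≤s (≤-reflexive (cong length (sym (filter-all (λ y → ¬? (y ≟ p)) (All.map (λ x≢y → x≢y ∘ sym) x∉xs)))))
... | no _ = s≤s (length-remove p xs-unique)

All-concatMap : ∀ {A B : Set} {P : B → Set} (f : A → List B) {xs} →
  All (λ x → All P (f x)) xs → All P (concatMap f xs)
All-concatMap f all = AllP.concat⁺ (AllP.map⁺ all)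

length-concatMap : ∀ {A B : Set} (f : A → List B) {c} xs → All (λ x → c ≤ length (f x)) xs →
  c * length xs ≤ length (concatMap f xs)
length-concatMap f {c} [] [] = ≤-reflexive (*-zeroʳ c)
length-concatMap f {c} (x ∷ xs) (c≤fx ∷ rest) = begin
  c * suc (length xs)                          ≡⟨ *-suc c (length xs) ⟩
  c + c * length xs                            ≤⟨ +-mono-≤ c≤fx (length-concatMap f xs rest) ⟩
  length (f x) + length (concatMap f xs)       ≡⟨ sym (length-++ (f x)) ⟩
  length (concatMap f (x ∷ xs))                ∎
  where open ≤-Reasoning

length-concatMap-++ : ∀ {A B : Set} (f : A → List B) {c d} xs ys →
  All (λ x → c ≤ length (f x)) xs → All (λ y → d ≤ length (f y)) ys →
  c * length xs + d * length ys ≤ length (concatMap f (xs ++ ys))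
length-concatMap-++ f xs ys c≤ d≤ = begin
  _ ≤⟨ +-mono-≤ (length-concatMap f xs c≤) (length-concatMap f ys d≤) ⟩
  length (concatMap f xs) + length (concatMap f ys) ≡⟨ sym (length-++ (concatMap f xs)) ⟩
  length (concatMap f xs ++ concatMap f ys)         ≡⟨ cong length (sym (concatMap-++ f xs ys)) ⟩
  length (concatMap f (xs ++ ys))                   ∎
  where open ≤-Reasoning

concatMap-unique : ∀ {A B : Set} (f : A → List B) (parent : B → A) →
  (∀ x → All (λ y → parent y ≡ x) (f x)) → (∀ x → Unique (f x)) →
  ∀ {xs} → Unique xs → Unique (concatMap f xs)
concatMap-unique f parent parent-f f-unique {[]} [] = []
concatMap-unique f parent parent-f f-unique {x ∷ xs} (x∉xs ∷ xs-unique) =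
  APP.++⁺ (f-unique x) (concatMap-unique f parent parent-f f-unique xs-unique)
    (All.map (λ y↦x → All.map (λ x≢pz y≡z → x≢pz (trans (sym y↦x) (cong parent y≡z))) parents-differ)
             (parent-f x))
  where
  parents-differ : All (λ z → x ≢ parent z) (concatMap f xs)
  parents-differ = All-concatMap f
    (All.map (λ {x′} x≢x′ → All.map (λ z↦x′ x≡pz → x≢x′ (trans x≡pz z↦x′)) (parent-f x′)) x∉xs)

AllPairs-mapWith : ∀ {A : Set} {P : A → Set} {R S : A → A → Set} {xs} → All P xs →
  (∀ {x y} → P x → P y → R x y → S x y) → AllPairs R xs → AllPairs S xs
AllPairs-mapWith [] f [] = []
AllPairs-mapWith (px ∷ pxs) f (rxs ∷ rest) =
  All.zipWith (λ (py , rxy) → f px py rxy) (pxs , rxs) ∷ AllPairs-mapWith pxs f rest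

module Walks {n : ℕ} (G : WGraph n) where
  open import Data.List.Membership.DecPropositional (_≟_ {n}) using (_∈?_)

  Vertex : Set
  Vertex = Fin n

  adj-sym : ∀ {u v} → Adj G u v → Adj G v u
  adj-sym {u} {v} u~v rewrite light-sym G v u | heavy-sym G v u = u~v

  adj-irrefl : ∀ u → ¬ Adj G u u
  adj-irrefl u u~u = false≢true (trans (sym (cong₂ _∨_ (light-irrefl G u) (heavy-irrefl G u))) u~u)

  edgeWeight-sym : ∀ u v → edgeWeight G u v ≡ edgeWeight G v u
  edgeWeight-sym u v rewrite light-sym G u v | heavy-sym G u v = refl

  light⇒¬heavy : ∀ {u v} → light G u v ≡ true → heavy G u v ≡ false
  light⇒¬heavy {u} {v} luv = subst (λ l → l ∧ heavy G u v ≡ false) luv (disjoint G u v)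

  heavy⇒¬light : ∀ {u v} → heavy G u v ≡ true → light G u v ≡ false
  heavy⇒¬light {u} {v} huv with light G u v | disjoint G u v
  ... | false | _ = refl
  ... | true | l∧h≡false = ⊥-elim (false≢true (trans (sym l∧h≡false) huv))

  -- A walk is the list of its vertices, most recent first, so that extending it is consing.
  data StartsAt (r : Vertex) : List Vertex → Set where
    here : StartsAt r (r ∷ [])
    there : ∀ {x W} → StartsAt r W → StartsAt r (x ∷ W)

  startsAt-∈ : ∀ {r W} → StartsAt r W → r ∈ W
  startsAt-∈ here = here refl
  startsAt-∈ (there st) = there (startsAt-∈ st)

  -- Defined as cycleWeight is, so that a wcycle weighs as much as its closed walk.
  weight : List Vertex → ℕ
  weight W = sum (map (λ e → edgeWeight G (proj₁ e) (proj₂ e)) (pairs W))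

  weight-∷ : ∀ x W → weight W ≤ weight (x ∷ W)
  weight-∷ x [] = z≤n
  weight-∷ x (y ∷ W) = m≤n+m (weight (y ∷ W)) (edgeWeight G x y)

  NoUTurn : Vertex → List Vertex → Set
  NoUTurn x (_ ∷ z ∷ _) = x ≢ z
  NoUTurn x _ = ⊤

  data NonBacktracking : List Vertex → Set where
    [] : NonBacktracking []
    [-] : ∀ {x} → NonBacktracking (x ∷ [])
    step : ∀ {x y W} → Adj G x y → NoUTurn x (y ∷ W) → NonBacktracking (y ∷ W) →
           NonBacktracking (x ∷ y ∷ W)

  nonBacktracking-tail : ∀ {x W} → NonBacktracking (x ∷ W) → NonBacktracking W
  nonBacktracking-tail [-] = []
  nonBacktracking-tail (step _ _ nb) = nb

  nonBacktracking-++⁻ˡ : ∀ W {es} → NonBacktracking (W ++ es) → NonBacktracking W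
  nonBacktracking-++⁻ˡ [] _ = []
  nonBacktracking-++⁻ˡ (x ∷ []) _ = [-]
  nonBacktracking-++⁻ˡ (x ∷ y ∷ []) (step x~y _ _) = step x~y tt [-]
  nonBacktracking-++⁻ˡ (x ∷ y ∷ z ∷ W) (step x~y x≢z nb) =
    step x~y x≢z (nonBacktracking-++⁻ˡ (y ∷ z ∷ W) nb)

  -- Non-backtracking walks and the cycles they close

  Cycle≤ : ℕ → Set
  Cycle≤ k = Σ (WCycle G) (λ C → cycleWeight C ≤ k)

  Cycle≤-mono : ∀ {j k} → j ≤ k → Cycle≤ j → Cycle≤ k
  Cycle≤-mono j≤k (C , C≤j) = C , ≤-trans C≤j j≤k

  takeBefore : ∀ {s} (W : List Vertex) → s ∈ W → List Vertex
  takeBefore (x ∷ W) (here _) = []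
  takeBefore (x ∷ W) (there s∈W) = x ∷ takeBefore W s∈W

  All-takeBefore : ∀ {P : Vertex → Set} {s} W (s∈W : s ∈ W) → All P W → All P (takeBefore W s∈W)
  All-takeBefore (x ∷ W) (here _) _ = []
  All-takeBefore (x ∷ W) (there s∈W) (px ∷ pW) = px ∷ All-takeBefore W s∈W pW

  unique-takeBefore : ∀ {s} W (s∈W : s ∈ W) → Unique W → Unique (s ∷ takeBefore W s∈W)
  unique-takeBefore (x ∷ W) (here _) _ = [] ∷ []
  unique-takeBefore (x ∷ W) (there s∈W) (x∉W ∷ W-unique) with unique-takeBefore W s∈W W-unique
  ... | s∉before ∷ before-unique =
    ((λ s≡x → All.lookup x∉W s∈W (sym s≡x)) ∷ s∉before) ∷ All-takeBefore W s∈W x∉W ∷ before-unique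

  adjacent-takeBefore : ∀ {s z} W (s∈W : s ∈ W) → NonBacktracking (z ∷ W) →
    All (λ e → Adj G (proj₁ e) (proj₂ e)) (pairs (z ∷ takeBefore W s∈W ++ s ∷ []))
  adjacent-takeBefore (x ∷ W) (here refl) (step z~x _ _) = z~x ∷ []
  adjacent-takeBefore (x ∷ W) (there s∈W) (step z~x _ nb) = z~x ∷ adjacent-takeBefore W s∈W nb

  weight-takeBefore : ∀ {s z} W (s∈W : s ∈ W) → weight (z ∷ takeBefore W s∈W ++ s ∷ []) ≤ weight (z ∷ W)
  weight-takeBefore {z = z} (x ∷ W) (here refl) = +-monoʳ-≤ (edgeWeight G z x) z≤n
  weight-takeBefore {z = z} (x ∷ W) (there s∈W) = +-monoʳ-≤ (edgeWeight G z x) (weight-takeBefore W s∈W)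

  -- The closed walk has length at least 3, since the walk neither stays put nor turns back.
  return⇒cycle : ∀ {s} W → Unique W → s ∈ W → NonBacktracking (s ∷ W) → Cycle≤ (weight (s ∷ W))
  return⇒cycle (x ∷ W) _ (here refl) (step s~s _ _) = ⊥-elim (adj-irrefl _ s~s)
  return⇒cycle (x ∷ y ∷ W) _ (there (here refl)) (step _ no-U-turn _) = ⊥-elim (no-U-turn refl)
  return⇒cycle {s} W@(_ ∷ _ ∷ _) W-unique s∈W@(there (there _)) nb =
    record { verts = s ∷ takeBefore W s∈W
           ; long = s≤s (s≤s (s≤s z≤n))
           ; distinct = unique-takeBefore W s∈W W-unique
           ; adjacent = adjacent-takeBefore W s∈W nb }
    , weight-takeBefore W s∈W

  unique⊎cycle : ∀ {W} → NonBacktracking W → Unique W ⊎ Cycle≤ (weight W)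
  unique⊎cycle [] = inj₁ []
  unique⊎cycle {x ∷ W} nb with unique⊎cycle (nonBacktracking-tail nb)
  ... | inj₂ C = inj₂ (Cycle≤-mono (weight-∷ x W) C)
  ... | inj₁ W-unique with x ∈? W
  ...   | yes x∈W = inj₂ (return⇒cycle W W-unique x∈W nb)
  ...   | no x∉W = inj₁ (¬Any⇒All¬ W x∉W ∷ W-unique)

  ¬unique⇒cycle : ∀ {W} → NonBacktracking W → ¬ Unique W → Cycle≤ (weight W)
  ¬unique⇒cycle nb ¬unique with unique⊎cycle nb
  ... | inj₁ unique = ⊥-elim (¬unique unique)
  ... | inj₂ C = C

  reverseAcc-nonBacktracking : ∀ {s b A B} → NonBacktracking (s ∷ A) → NonBacktracking (s ∷ b ∷ B) →
    NoUTurn b (s ∷ A) → NonBacktracking (reverseAcc (s ∷ A) (b ∷ B))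
  reverseAcc-nonBacktracking nbA (step s~b _ [-]) b↛ = step (adj-sym s~b) b↛ nbA
  reverseAcc-nonBacktracking nbA (step s~b s↛ nbB@(step _ _ _)) b↛ =
    reverseAcc-nonBacktracking (step (adj-sym s~b) b↛ nbA) nbB (λ b′≡s → s↛ (sym b′≡s))

  weight-reverseAcc : ∀ s A B → weight (reverseAcc (s ∷ A) B) ≡ weight (s ∷ A) + weight (s ∷ B)
  weight-reverseAcc s A [] = sym (+-identityʳ (weight (s ∷ A)))
  weight-reverseAcc s A (b ∷ B) = begin
    weight (reverseAcc (b ∷ s ∷ A) B)
      ≡⟨ weight-reverseAcc b (s ∷ A) B ⟩
    (edgeWeight G b s + weight (s ∷ A)) + weight (b ∷ B)
      ≡⟨ cong (λ w → (w + weight (s ∷ A)) + weight (b ∷ B)) (edgeWeight-sym b s) ⟩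
    (edgeWeight G s b + weight (s ∷ A)) + weight (b ∷ B)
      ≡⟨ cong (_+ weight (b ∷ B)) (+-comm (edgeWeight G s b) (weight (s ∷ A))) ⟩
    (weight (s ∷ A) + edgeWeight G s b) + weight (b ∷ B)
      ≡⟨ +-assoc (weight (s ∷ A)) (edgeWeight G s b) (weight (b ∷ B)) ⟩
    weight (s ∷ A) + weight (s ∷ b ∷ B)
      ∎
    where open ≡-Reasoning

  reverseAcc-¬unique : ∀ {r acc W} → StartsAt r W → r ∈ acc → ¬ Unique (reverseAcc acc W)
  reverseAcc-¬unique here r∈acc (r∉acc ∷ _) = All.lookup r∉acc r∈acc refl
  reverseAcc-¬unique (there st) r∈acc = reverseAcc-¬unique st (there r∈acc)

  -- Walking back along one walk and out along the other is a non-backtracking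
  -- closed walk at r, so it repeats a vertex.
  diverging-walks⇒cycle : ∀ {r x b A B} → NonBacktracking (x ∷ A) → NonBacktracking (x ∷ b ∷ B) →
    NoUTurn b (x ∷ A) → StartsAt r (x ∷ A) → StartsAt r (b ∷ B) →
    Cycle≤ (weight (x ∷ A) + weight (x ∷ b ∷ B))
  diverging-walks⇒cycle {x = x} {b} {A} {B} nbA nbB b↛ stA stB =
    subst Cycle≤ (weight-reverseAcc x A (b ∷ B))
      (¬unique⇒cycle (reverseAcc-nonBacktracking nbA nbB b↛) (reverseAcc-¬unique stB (startsAt-∈ stA)))

  distinct-walks⇒cycle : ∀ {r x A B} → NonBacktracking (x ∷ A) → NonBacktracking (x ∷ B) →
    StartsAt r (x ∷ A) → StartsAt r (x ∷ B) → A ≢ B → Cycle≤ (weight (x ∷ A) + weight (x ∷ B))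
  distinct-walks⇒cycle {A = []} {[]} _ _ _ _ A≢B = ⊥-elim (A≢B refl)
  distinct-walks⇒cycle {A = []} {_ ∷ _} nbA nbB stA (there stB) _ = diverging-walks⇒cycle nbA nbB tt stA stB
  distinct-walks⇒cycle {x = x} {A = A@(_ ∷ _)} {[]} nbA nbB (there stA) stB _ =
    subst Cycle≤ (+-comm (weight (x ∷ [])) (weight (x ∷ A))) (diverging-walks⇒cycle nbB nbA tt stB stA)
  distinct-walks⇒cycle {x = x} {a ∷ A} {b ∷ B} nbA nbB (there stA) (there stB) A≢B with a ≟ b
  ... | yes refl = Cycle≤-mono (+-mono-≤ (weight-∷ x (a ∷ A)) (weight-∷ x (a ∷ B)))
    (distinct-walks⇒cycle (nonBacktracking-tail nbA) (nonBacktracking-tail nbB) stA stB (A≢B ∘ cong (a ∷_)))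
  ... | no a≢b = diverging-walks⇒cycle nbA nbB (λ b≡a → a≢b (sym b≡a)) (there stA) stB

  startsAt-∷ʳ : ∀ {u v W} → StartsAt u W → StartsAt v (W ++ v ∷ [])
  startsAt-∷ʳ here = there here
  startsAt-∷ʳ (there st) = there (startsAt-∷ʳ st)

  weight-∷ʳ : ∀ {u v W} → StartsAt u W → weight (W ++ v ∷ []) ≡ weight W + edgeWeight G u v
  weight-∷ʳ {u} {v} here = +-identityʳ (edgeWeight G u v)
  weight-∷ʳ {u} {v} (there {x} {y ∷ W} st) =
    trans (cong (edgeWeight G x y +_) (weight-∷ʳ st))
          (sym (+-assoc (edgeWeight G x y) (weight (y ∷ W)) (edgeWeight G u v)))

  ¬nonBacktracking-return : ∀ {u v W} → StartsAt u W → ¬ NonBacktracking ((W ++ v ∷ []) ++ u ∷ [])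
  ¬nonBacktracking-return here (step _ u-turn _) = u-turn refl
  ¬nonBacktracking-return (there st) nb = ¬nonBacktracking-return st (nonBacktracking-tail nb)

  -- Trees of non-backtracking walks

  record EdgeClass (R : Vertex → Vertex → Bool) (w : ℕ) : Set where
    field
      symmetric : ∀ x y → R x y ≡ R y x
      adjacency : ∀ {x y} → R x y ≡ true → Adj G x y
      weight-of : ∀ {x y} → R x y ≡ true → edgeWeight G x y ≡ w

  light-class : EdgeClass (light G) 1
  light-class = record
    { symmetric = light-sym G
    ; adjacency = λ {x} {y} lxy → cong (_∨ heavy G x y) lxy
    ; weight-of = λ {x} {y} lxy → cong (λ l → if l then 1 else (if heavy G x y then 2 else 0)) lxy }

  heavy-class : EdgeClass (heavy G) 2
  heavy-class = record
    { symmetric = heavy-sym G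
    ; adjacency = λ hxy → cong₂ _∨_ (heavy⇒¬light hxy) hxy
    ; weight-of = λ hxy → cong₂ (λ l h → if l then 1 else (if h then 2 else 0)) (heavy⇒¬light hxy) hxy }

  lastStepIn : (Vertex → Vertex → Bool) → List Vertex → Bool
  lastStepIn R (x ∷ p ∷ _) = R x p
  lastStepIn R _ = false

  lastStepIn-++⁻ : ∀ R W es → lastStepIn R (W ++ es) ≡ false → lastStepIn R W ≡ false
  lastStepIn-++⁻ R [] es _ = refl
  lastStepIn-++⁻ R (x ∷ []) es _ = refl
  lastStepIn-++⁻ R (x ∷ p ∷ W) es not-last = not-last

  light-last⇒¬heavy-last : ∀ W es → lastStepIn (light G) W ≡ true → lastStepIn (heavy G) (W ++ es) ≡ false
  light-last⇒¬heavy-last (x ∷ p ∷ W) es light-last = light⇒¬heavy light-last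

  heavy-last⇒¬light-last : ∀ W es → lastStepIn (heavy G) W ≡ true → lastStepIn (light G) (W ++ es) ≡ false
  heavy-last⇒¬light-last (x ∷ p ∷ W) es heavy-last = heavy⇒¬light heavy-last

  neighbours : (Vertex → Vertex → Bool) → Vertex → List Vertex
  neighbours R x = filterᵇ (R x) (allFin n)

  length-neighbours : ∀ R x → length (neighbours R x) ≡ degree R x
  length-neighbours R x = length-filterᵇ (R x) (allFin n)

  neighbours-unique : ∀ R x → Unique (neighbours R x)
  neighbours-unique R x = UniqueP.filter⁺ (T? ∘ R x) (UniqueP.allFin⁺ n)

  neighbours-sound : ∀ R x → All (λ y → R x y ≡ true) (neighbours R x)
  neighbours-sound R x = All.map (Equivalence.to T-≡) (AllP.all-filter (T? ∘ R x) (allFin n))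

  neighbour : ∀ R {d} → (∀ x → degree R x ≡ d) → 1 ≤ d → ∀ u → Σ Vertex (λ v → R u v ≡ true)
  neighbour R R-regular 1≤d u with neighbours R u | neighbours-sound R u | length-neighbours R u
  ... | [] | _ | 0≡degree = ⊥-elim (1+n≰n (subst (1 ≤_) (trans (sym (R-regular u)) (sym 0≡degree)) 1≤d))
  ... | v ∷ _ | Ruv ∷ _ | _ = v , Ruv

  successors : (Vertex → Vertex → Bool) → List Vertex → List Vertex
  successors R [] = []
  successors R (x ∷ []) = neighbours R x
  successors R (x ∷ p ∷ _) = filter (λ y → ¬? (y ≟ p)) (neighbours R x)

  successors-sound : ∀ R x L → All (λ y → R x y ≡ true × NoUTurn y (x ∷ L)) (successors R (x ∷ L))
  successors-sound R x [] = All.map (_, tt) (neighbours-sound R x)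
  successors-sound R x (p ∷ L) = All.zip
    ( AllP.filter⁺ (λ y → ¬? (y ≟ p)) (neighbours-sound R x)
    , AllP.all-filter (λ y → ¬? (y ≟ p)) (neighbours R x))

  successors-unique : ∀ R W → Unique (successors R W)
  successors-unique R [] = []
  successors-unique R (x ∷ []) = neighbours-unique R x
  successors-unique R (x ∷ p ∷ _) = UniqueP.filter⁺ (λ y → ¬? (y ≟ p)) (neighbours-unique R x)

  successors-length : ∀ R x L → degree R x ∸ 1 ≤ length (successors R (x ∷ L))
  successors-length R x [] = ≤-trans (m∸n≤m (degree R x) 1) (≤-reflexive (sym (length-neighbours R x)))
  successors-length R x (p ∷ L) = m≤n+o⇒m∸n≤o (degree R x) 1
    (subst (_≤ suc (length (successors R (x ∷ p ∷ L)))) (length-neighbours R x)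
           (length-remove p (neighbours-unique R x)))

  successors-length-fresh : ∀ R x L → lastStepIn R (x ∷ L) ≡ false →
    degree R x ≤ length (successors R (x ∷ L))
  successors-length-fresh R x [] _ = ≤-reflexive (sym (length-neighbours R x))
  successors-length-fresh R x (p ∷ L) Rxp≡false = ≤-reflexive (sym (begin
    length (filter (λ y → ¬? (y ≟ p)) (neighbours R x)) ≡⟨ cong length (filter-all (λ y → ¬? (y ≟ p)) y≢p) ⟩
    length (neighbours R x)                             ≡⟨ length-neighbours R x ⟩
    degree R x                                          ∎))
    where
    open ≡-Reasoning
    y≢p : All (λ y → ¬ y ≡ p) (neighbours R x)
    y≢p = All.map (λ { Rxy refl → false≢true (trans (sym Rxp≡false) Rxy) }) (neighbours-sound R x)

  -- es lists the vertices visited before the root, most recent first.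
  record RootedWalk (r : Vertex) (es : List Vertex) (W : List Vertex) : Set where
    constructor rooted
    field
      nonBacktracking : NonBacktracking (W ++ es)
      startsAt : StartsAt r W
  open RootedWalk

  record WalkFamily (r : Vertex) (es : List Vertex) (t : ℕ) : Set where
    field
      walks : List (List Vertex)
      distinct : Unique walks
      valid : All (λ W → RootedWalk r es W × weight W ≤ t) walks
  open WalkFamily

  module WalkTree {a b : ℕ} (regular : IsRegular G a b) (r : Vertex) (es : List Vertex) where

    RootedOfWeight : ℕ → List Vertex → Set
    RootedOfWeight k W = RootedWalk r es W × weight W ≡ k

    -- An R-fresh walk extends along every R-edge at its end.
    Fresh : (Vertex → Vertex → Bool) → ℕ → List Vertex → Set
    Fresh R k W = RootedOfWeight k W × lastStepIn R (W ++ es) ≡ false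

    extensions : (Vertex → Vertex → Bool) → List Vertex → List (List Vertex)
    extensions R W = map (_∷ W) (successors R (W ++ es))

    extensions-grow : ∀ {R w} → EdgeClass R w → ∀ {k W} → RootedOfWeight k W →
      All (λ W′ → RootedOfWeight (w + k) W′ × lastStepIn R W′ ≡ true) (extensions R W)
    extensions-grow {R} {w} class {k} {x ∷ W} (rooted nb st , weight≡k) =
      AllP.map⁺ (All.map grow (successors-sound R x (W ++ es)))
      where
      open EdgeClass class
      grow : ∀ {y} → R x y ≡ true × NoUTurn y (x ∷ W ++ es) →
        RootedOfWeight (w + k) (y ∷ x ∷ W) × lastStepIn R (y ∷ x ∷ W) ≡ true
      grow {y} (Rxy , y↛) =
        (rooted (step (adjacency Ryx) y↛ nb) (there st) , cong₂ _+_ (weight-of Ryx) weight≡k) , Ryx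
        where
        Ryx : R y x ≡ true
        Ryx = trans (symmetric y x) Rxy

    extensions-parent : ∀ R W → All (λ W′ → drop 1 W′ ≡ W) (extensions R W)
    extensions-parent R W = AllP.map⁺ (All.tabulate (λ _ → refl))

    extensions-unique : ∀ R W → Unique (extensions R W)
    extensions-unique R W = UniqueP.map⁺ ∷-injectiveˡ (successors-unique R (W ++ es))

    extensions-length : ∀ R {d} → (∀ x → degree R x ≡ d) → ∀ {W} → StartsAt r W →
      d ∸ 1 ≤ length (extensions R W)
    extensions-length R {d} R-regular {x ∷ W} _ = begin
      d ∸ 1                                ≡⟨ cong (_∸ 1) (sym (R-regular x)) ⟩
      degree R x ∸ 1                       ≤⟨ successors-length R x (W ++ es) ⟩
      length (successors R (x ∷ W ++ es))  ≡⟨ sym (length-map (_∷ x ∷ W) (successors R (x ∷ W ++ es))) ⟩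
      length (extensions R (x ∷ W))        ∎
      where open ≤-Reasoning

    extensions-length-fresh : ∀ R {d} → (∀ x → degree R x ≡ d) → ∀ {W} → StartsAt r W →
      lastStepIn R (W ++ es) ≡ false → d ≤ length (extensions R W)
    extensions-length-fresh R {d} R-regular {x ∷ W} _ fresh = begin
      d                                    ≡⟨ sym (R-regular x) ⟩
      degree R x                           ≤⟨ successors-length-fresh R x (W ++ es) fresh ⟩
      length (successors R (x ∷ W ++ es))  ≡⟨ sym (length-map (_∷ x ∷ W) (successors R (x ∷ W ++ es))) ⟩
      length (extensions R (x ∷ W))        ∎
      where open ≤-Reasoning

    module Layers (L₀ H₀ : List (List Vertex))
                  (L₀-fresh : All (Fresh (heavy G) 0) L₀) (H₀-fresh : All (Fresh (light G) 0) H₀)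
                  (layer₀-unique : Unique (L₀ ++ H₀)) where

      mutual
        lightLayer : ℕ → List (List Vertex)
        lightLayer zero = L₀
        lightLayer (suc k) = concatMap (extensions (light G)) (layer k)

        heavyLayer : ℕ → List (List Vertex)
        heavyLayer zero = H₀
        heavyLayer (suc zero) = []
        heavyLayer (suc (suc k)) = concatMap (extensions (heavy G)) (layer k)

        layer : ℕ → List (List Vertex)
        layer k = lightLayer k ++ heavyLayer k

      ball : ℕ → List (List Vertex)
      ball zero = layer zero
      ball (suc t) = ball t ++ layer (suc t)

      mutual
        lightLayer-fresh : ∀ k → All (Fresh (heavy G) k) (lightLayer k)
        lightLayer-fresh zero = L₀-fresh
        lightLayer-fresh (suc k) =
          All.map (λ {W} (rw , light-last) → rw , light-last⇒¬heavy-last W es light-last)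
                  (lightLayer-light-last k)

        lightLayer-light-last : ∀ k →
          All (λ W → RootedOfWeight (suc k) W × lastStepIn (light G) W ≡ true) (lightLayer (suc k))
        lightLayer-light-last k =
          All-concatMap (extensions (light G)) (All.map (extensions-grow light-class) (layer-rooted k))

        heavyLayer-fresh : ∀ k → All (Fresh (light G) k) (heavyLayer k)
        heavyLayer-fresh zero = H₀-fresh
        heavyLayer-fresh (suc zero) = []
        heavyLayer-fresh (suc (suc k)) = All-concatMap (extensions (heavy G)) (All.map
          (λ rw → All.map (λ {W} (rw′ , heavy-last) → rw′ , heavy-last⇒¬light-last W es heavy-last)
                          (extensions-grow heavy-class rw))
          (layer-rooted k))

        layer-rooted : ∀ k → All (RootedOfWeight k) (layer k)
        layer-rooted k = AllP.++⁺ (All.map proj₁ (lightLayer-fresh k)) (All.map proj₁ (heavyLayer-fresh k))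

      light-last≢fresh : ∀ {k W W′} → lastStepIn (light G) W ≡ true → Fresh (light G) k W′ → W ≢ W′
      light-last≢fresh {W = W} light-last (_ , fresh) refl =
        false≢true (trans (sym (lastStepIn-++⁻ (light G) W es fresh)) light-last)

      mutual
        layer-unique : ∀ k → Unique (layer k)
        layer-unique zero = layer₀-unique
        layer-unique (suc k) = APP.++⁺ (lightLayer-unique k) (heavyLayer-unique k)
          (All.map (λ (_ , light-last) → All.map (light-last≢fresh light-last) (heavyLayer-fresh (suc k)))
                   (lightLayer-light-last k))

        lightLayer-unique : ∀ k → Unique (lightLayer (suc k))
        lightLayer-unique k = concatMap-unique (extensions (light G)) (drop 1)
          (extensions-parent (light G)) (extensions-unique (light G)) (layer-unique k)

        heavyLayer-unique : ∀ k → Unique (heavyLayer (suc k))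
        heavyLayer-unique zero = []
        heavyLayer-unique (suc k) = concatMap-unique (extensions (heavy G)) (drop 1)
          (extensions-parent (heavy G)) (extensions-unique (heavy G)) (layer-unique k)

      ball-valid : ∀ t → All (λ W → RootedWalk r es W × weight W ≤ t) (ball t)
      ball-valid zero = All.map (λ (rw , weight≡0) → rw , ≤-reflexive weight≡0) (layer-rooted zero)
      ball-valid (suc t) = AllP.++⁺
        (All.map (λ (rw , weight≤t) → rw , m≤n⇒m≤1+n weight≤t) (ball-valid t))
        (All.map (λ (rw , weight≡1+t) → rw , ≤-reflexive weight≡1+t) (layer-rooted (suc t)))

      ball-unique : ∀ t → Unique (ball t)
      ball-unique zero = layer-unique zero
      ball-unique (suc t) = APP.++⁺ (ball-unique t) (layer-unique (suc t))
        (All.map (λ {W} (_ , weight≤t) → All.map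
          (λ (_ , weight≡1+t) W≡W′ → 1+n≰n (subst (_≤ t) (trans (cong weight W≡W′) weight≡1+t) weight≤t))
          (layer-rooted (suc t))) (ball-valid t))

      ball-family : ∀ t → WalkFamily r es t
      ball-family t = record { walks = ball t ; distinct = ball-unique t ; valid = ball-valid t }

      light-step : ∀ k →
        (a ∸ 1) * length (lightLayer k) + a * length (heavyLayer k) ≤ length (lightLayer (suc k))
      light-step k = length-concatMap-++ (extensions (light G)) (lightLayer k) (heavyLayer k)
        (All.map (λ ((rw , _) , _) → extensions-length (light G) (proj₁ regular) (startsAt rw))
                 (lightLayer-fresh k))
        (All.map (λ ((rw , _) , fresh) → extensions-length-fresh (light G) (proj₁ regular) (startsAt rw) fresh)
                 (heavyLayer-fresh k))

      heavy-step : ∀ k →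
        (b ∸ 1) * length (heavyLayer k) + b * length (lightLayer k) ≤ length (heavyLayer (suc (suc k)))
      heavy-step k = ≤-trans (≤-reflexive (+-comm ((b ∸ 1) * length (heavyLayer k)) (b * length (lightLayer k))))
        (length-concatMap-++ (extensions (heavy G)) (lightLayer k) (heavyLayer k)
          (All.map (λ ((rw , _) , fresh) → extensions-length-fresh (heavy G) (proj₂ regular) (startsAt rw) fresh)
                   (lightLayer-fresh k))
          (All.map (λ ((rw , _) , _) → extensions-length (heavy G) (proj₂ regular) (startsAt rw))
                   (heavyLayer-fresh k)))

      module Counting {L₀′ H₀′ L₁′ : ℕ} (L₀′≤ : L₀′ ≤ length L₀) (H₀′≤ : H₀′ ≤ length H₀)
                      (L₁′≤ : L₁′ ≤ length (lightLayer 1)) where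

        L H : ℕ → ℕ
        L = Lseq a b L₀′ H₀′ L₁′ 0
        H = Hseq a b L₀′ H₀′ L₁′ 0

        mutual
          lightLayer-length : ∀ k → L k ≤ length (lightLayer k)
          lightLayer-length zero = L₀′≤
          lightLayer-length (suc zero) = L₁′≤
          lightLayer-length (suc (suc k)) = ≤-trans
            (+-mono-≤ (*-monoʳ-≤ (a ∸ 1) (lightLayer-length (suc k)))
                      (*-monoʳ-≤ a (heavyLayer-length (suc k))))
            (light-step (suc k))

          heavyLayer-length : ∀ k → H k ≤ length (heavyLayer k)
          heavyLayer-length zero = H₀′≤
          heavyLayer-length (suc zero) = z≤n
          heavyLayer-length (suc (suc k)) = ≤-trans
            (+-mono-≤ (*-monoʳ-≤ (b ∸ 1) (heavyLayer-length k)) (*-monoʳ-≤ b (lightLayer-length k)))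
            (heavy-step k)

        layer-length : ∀ k → L k + H k ≤ length (layer k)
        layer-length k = ≤-trans (+-mono-≤ (lightLayer-length k) (heavyLayer-length k))
                                 (≤-reflexive (sym (length-++ (lightLayer k))))

        ball-length : ∀ t → sumUpTo t (λ i → L i + H i) ≤ length (ball t)
        ball-length zero = layer-length zero
        ball-length (suc t) = ≤-trans (+-mono-≤ (ball-length t) (layer-length (suc t)))
                                      (≤-reflexive (sym (length-++ (ball t))))

  module Balls {a b : ℕ} (regular : IsRegular G a b) where

    vertex-ball : ∀ r t → Σ (WalkFamily r [] t) λ F →
      sumUpTo t (λ i → Lseq a b 1 0 a 0 i + Hseq a b 1 0 a 0 i) ≤ length (walks F)
    vertex-ball r t = ball-family t , ball-length t
      where
      open WalkTree regular r []
      open Layers ((r ∷ []) ∷ []) [] (((rooted [-] here , refl) , refl) ∷ []) [] ([] ∷ [])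
      open Counting ≤-refl z≤n (≤-trans (≤-reflexive (sym (*-identityʳ a)))
        (length-concatMap (extensions (light G)) ((r ∷ []) ∷ [])
          (extensions-length-fresh (light G) (proj₁ regular) here refl ∷ [])))

    light-edge-ball : ∀ {u v} → light G u v ≡ true → ∀ t → Σ (WalkFamily u (v ∷ []) t) λ F →
      sumUpTo t (λ i → Lseq a b 1 0 (a ∸ 1) 0 i + Hseq a b 1 0 (a ∸ 1) 0 i) ≤ length (walks F)
    light-edge-ball {u} {v} luv t = ball-family t , ball-length t
      where
      open WalkTree regular u (v ∷ [])
      root : Fresh (heavy G) 0 (u ∷ [])
      root = (rooted (step (EdgeClass.adjacency light-class luv) tt [-]) here , refl) , light⇒¬heavy luv
      open Layers ((u ∷ []) ∷ []) [] (root ∷ []) [] ([] ∷ [])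
      open Counting ≤-refl z≤n (≤-trans (≤-reflexive (sym (*-identityʳ (a ∸ 1))))
        (length-concatMap (extensions (light G)) ((u ∷ []) ∷ [])
          (extensions-length (light G) (proj₁ regular) here ∷ [])))

    heavy-edge-ball : ∀ {u v} → heavy G u v ≡ true → ∀ t → Σ (WalkFamily u (v ∷ []) t) λ F →
      sumUpTo t (λ i → Lseq a b 0 1 a 0 i + Hseq a b 0 1 a 0 i) ≤ length (walks F)
    heavy-edge-ball {u} {v} huv t = ball-family t , ball-length t
      where
      open WalkTree regular u (v ∷ [])
      root : Fresh (light G) 0 (u ∷ [])
      root = (rooted (step (EdgeClass.adjacency heavy-class huv) tt [-]) here , refl) , heavy⇒¬light huv
      open Layers [] ((u ∷ []) ∷ []) [] (root ∷ []) ([] ∷ [])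
      open Counting z≤n ≤-refl (≤-trans (≤-reflexive (sym (*-identityʳ a)))
        (length-concatMap (extensions (light G)) ((u ∷ []) ∷ [])
          (extensions-length-fresh (light G) (proj₁ regular) here (heavy⇒¬light huv) ∷ [])))

  -- Girth

  endpoint : Vertex → List Vertex → Vertex
  endpoint r [] = r
  endpoint r (x ∷ _) = x

  module Girth {g : ℕ} (girth≤ : ∀ {k} → Cycle≤ k → g ≤ k) where

    endpoint-injective : ∀ {r es t W₁ W₂} → t + t < g →
      RootedWalk r es W₁ × weight W₁ ≤ t → RootedWalk r es W₂ × weight W₂ ≤ t →
      W₁ ≢ W₂ → endpoint r W₁ ≢ endpoint r W₂
    endpoint-injective {W₁ = x ∷ A} {.x ∷ B} 2t<g (rooted nb₁ st₁ , w₁≤t) (rooted nb₂ st₂ , w₂≤t) W₁≢W₂ refl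
      =
      <⇒≱ 2t<g (≤-trans (girth≤ C) (+-mono-≤ w₁≤t w₂≤t))
      where
      C = distinct-walks⇒cycle (nonBacktracking-++⁻ˡ (x ∷ A) nb₁) (nonBacktracking-++⁻ˡ (x ∷ B) nb₂)
                               st₁ st₂ (W₁≢W₂ ∘ cong (x ∷_))

    -- A walk from u continued back through v, and a walk from v that avoids u
    -- at its first step, are distinct walks from v.
    endpoint-separated : ∀ {u v t₁ t₂ W₁ W₂} → t₁ + edgeWeight G u v + t₂ < g →
      RootedWalk u (v ∷ []) W₁ × weight W₁ ≤ t₁ → RootedWalk v (u ∷ []) W₂ × weight W₂ ≤ t₂ →
      endpoint u W₁ ≢ endpoint v W₂
    endpoint-separated {u} {v} {W₁ = x ∷ A} {.x ∷ B} short (rooted nb₁ st₁ , w₁≤t₁) (rooted nb₂ st₂ , w₂≤t₂) refl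
      = <⇒≱ short (≤-trans (girth≤ C) (begin
        weight (x ∷ A ++ v ∷ []) + weight (x ∷ B)
          ≡⟨ cong (_+ weight (x ∷ B)) (weight-∷ʳ st₁) ⟩
        weight (x ∷ A) + edgeWeight G u v + weight (x ∷ B)
          ≤⟨ +-mono-≤ (+-monoˡ-≤ (edgeWeight G u v) w₁≤t₁) w₂≤t₂ ⟩
        _ ∎))
      where
      open ≤-Reasoning
      A++v≢B : A ++ v ∷ [] ≢ B
      A++v≢B refl = ¬nonBacktracking-return st₁ nb₂
      C = distinct-walks⇒cycle nb₁ (nonBacktracking-++⁻ˡ (x ∷ B) nb₂) (startsAt-∷ʳ st₁) st₂ A++v≢B

    endpoints-unique : ∀ {r es t} → t + t < g → (F : WalkFamily r es t) →
      Unique (map (endpoint r) (walks F))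
    endpoints-unique 2t<g F = APP.map⁺ (AllPairs-mapWith (valid F) (endpoint-injective 2t<g) (distinct F))

    family-size≤ : ∀ {r es t} → t + t < g → (F : WalkFamily r es t) → length (walks F) ≤ n
    family-size≤ {r} 2t<g F =
      subst (_≤ n) (length-map (endpoint r) (walks F)) (unique-length≤ (endpoints-unique 2t<g F))

    families-size≤ : ∀ {u v t₁ t₂} → t₁ + t₁ < g → t₂ + t₂ < g → t₁ + edgeWeight G u v + t₂ < g →
      (F₁ : WalkFamily u (v ∷ []) t₁) (F₂ : WalkFamily v (u ∷ []) t₂) →
      length (walks F₁) + length (walks F₂) ≤ n
    families-size≤ {u} {v} 2t₁<g 2t₂<g short F₁ F₂ = subst (_≤ n) length≡ (unique-length≤ (APP.++⁺
      (endpoints-unique 2t₁<g F₁) (endpoints-unique 2t₂<g F₂)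
      (AllP.map⁺ (All.map (λ W₁-valid → AllP.map⁺ (All.map (endpoint-separated short W₁-valid) (valid F₂)))
                          (valid F₁)))))
      where
      length≡ : length (map (endpoint u) (walks F₁) ++ map (endpoint v) (walks F₂))
              ≡ length (walks F₁) + length (walks F₂)
      length≡ = trans (length-++ (map (endpoint u) (walks F₁)))
                      (cong₂ _+_ (length-map (endpoint u) (walks F₁)) (length-map (endpoint v) (walks F₂)))

module Bounds {n : ℕ} {G : WGraph n} {a b g : ℕ} (regular : IsRegular G a b) (girth : HasGirth G g) where
  open Walks G
  open Balls regular
  open Girth (λ (C , C≤k) → ≤-trans (proj₂ girth C) C≤k)

  root : Vertex
  root with verts (proj₁ (proj₁ girth)) | long (proj₁ (proj₁ girth))
  ... | x ∷ _ | _ = x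

  vertex-bound : ∀ t → t + t < g → sumUpTo t (λ i → Lseq a b 1 0 a 0 i + Hseq a b 1 0 a 0 i) ≤ n
  vertex-bound t 2t<g with vertex-ball root t
  ... | F , size≤ = ≤-trans size≤ (family-size≤ 2t<g F)

  light-edge-bound : ∀ t → 1 ≤ a → t + 1 + t < g →
    let S = sumUpTo t (λ i → Lseq a b 1 0 (a ∸ 1) 0 i + Hseq a b 1 0 (a ∸ 1) 0 i) in S + S ≤ n
  light-edge-bound t 1≤a short with neighbour (light G) (proj₁ regular) 1≤a root
  ... | v , luv with light-edge-ball luv t | light-edge-ball (trans (light-sym G v root) luv) t
  ...   | F₁ , size₁ | F₂ , size₂ =
    ≤-trans (+-mono-≤ size₁ size₂) (families-size≤ 2t<g 2t<g short′ F₁ F₂)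
    where
    2t<g : t + t < g
    2t<g = ≤-trans (s≤s (+-monoˡ-≤ t (m≤m+n t 1))) short
    short′ : t + edgeWeight G root v + t < g
    short′ = subst (λ w → t + w + t < g) (sym (EdgeClass.weight-of light-class luv)) short

  heavy-edge-bound : ∀ t₁ t₂ → 1 ≤ b → t₁ + t₁ < g → t₂ + t₂ < g → t₁ + 2 + t₂ < g →
    sumUpTo t₁ (λ i → Lseq a b 0 1 a 0 i + Hseq a b 0 1 a 0 i)
      + sumUpTo t₂ (λ i → Lseq a b 0 1 a 0 i + Hseq a b 0 1 a 0 i) ≤ n
  heavy-edge-bound t₁ t₂ 1≤b 2t₁<g 2t₂<g short with neighbour (heavy G) (proj₂ regular) 1≤b root
  ... | v , huv with heavy-edge-ball huv t₁ | heavy-edge-ball (trans (heavy-sym G v root) huv) t₂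
  ...   | F₁ , size₁ | F₂ , size₂ =
    ≤-trans (+-mono-≤ size₁ size₂) (families-size≤ 2t₁<g 2t₂<g short′ F₁ F₂)
    where
    short′ : t₁ + edgeWeight G root v + t₂ < g
    short′ = subst (λ w → t₁ + w + t₂ < g) (sym (EdgeClass.weight-of heavy-class huv)) short

theorem10 :
    ((a b g : ℕ) → 1 ≤ a → 1 ≤ b → 3 ≤ g →
      ((g % 2 ≡ 1) → (n : ℕ) (G : WGraph n) → IsABG G a b g → M₁⁺ a b g ≤ n)
      × ((g % 2 ≡ 0) → (n : ℕ) (G : WGraph n) → IsABG G a b g → M₂⁺ a b g ≤ n))
    × (M₃⁺ 1 2 10 ≡ 16 × ((n : ℕ) (G : WGraph n) → IsABG G 1 2 10 → M₃⁺ 1 2 10 ≤ n))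
theorem10 = (λ a b g 1≤a _ 3≤g → odd-girth a b g 3≤g , even-girth a b g 1≤a 3≤g) , refl , girth-10
  where
  odd-girth : ∀ a b g → 3 ≤ g → g % 2 ≡ 1 → (n : ℕ) (G : WGraph n) → IsABG G a b g → M₁⁺ a b g ≤ n
  odd-girth a b g 3≤g _ n G (regular , girth) = plus-≤ a b M₁≤n (regular⇒even-order {G = G} regular)
    where
    open Bounds regular girth
    M₁≤n : M₁ a b g ≤ n
    M₁≤n = vertex-bound ((g ∸ 1) / 2) (odd-radius (≤-trans (s≤s z≤n) 3≤g))

  even-girth : ∀ a b g → 1 ≤ a → 3 ≤ g → g % 2 ≡ 0 → (n : ℕ) (G : WGraph n) → IsABG G a b g → M₂⁺ a b g ≤ n
  even-girth a b g 1≤a 3≤g _ n G (regular , girth) = plus-≤ a b M₂≤n (regular⇒even-order {G = G} regular)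
    where
    open Bounds regular girth
    M₂≤n : M₂ a b g ≤ n
    M₂≤n = subst (_≤ n) (sym (M₂-double a b g))
                 (light-edge-bound ((g ∸ 2) / 2) 1≤a (even-radius (≤-trans (s≤s (s≤s z≤n)) 3≤g)))

  girth-10 : (n : ℕ) (G : WGraph n) → IsABG G 1 2 10 → M₃⁺ 1 2 10 ≤ n
  girth-10 n G (regular , girth) = plus-≤ 1 2 M₃≤n (regular⇒even-order {G = G} regular)
    where
    open Bounds regular girth
    -- M₃ 1 2 10 = 15 = 9 + 6: the balls of radius 4 and 3 around the ends of a heavy edge.
    M₃≤n : M₃ 1 2 10 ≤ n
    M₃≤n = heavy-edge-bound 4 3 (s≤s z≤n) (from-yes (8 <? 10)) (from-yes (6 <? 10)) (from-yes (9 <? 10))
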